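{- Let $m\ge 1$ and let $n_1,\ldots,n_m$ be positive integers with $N=n_1+\cdots+n_m$ odd. Suppose more than one of the $n_j$ is odd. Then the number of distinct dihedral necklaces with these bead counts satisfies $$\gamma(D_N,\mathbf{n}^m)=\frac{1}{2}\gamma(C_N,\mathbf{n}^m).$$
   Context: A cyclic (resp. dihedral) necklace is a coloring in $m$ colors of the vertices of a regular $N$-gon, two colorings being equivalent if one is obtained from the other by an element of the cyclic group $C_N$ of rotations (resp. the dihedral group $D_N$ of rotations and reflections) of the $N$-gon. $\gamma(C_N,\mathbf{n}^m)$ (resp. $\gamma(D_N,\mathbf{n}^m)$) denotes the number of distinct cyclic (resp. dihedral) necklaces containing exactly $n_j$ beads of the $j$-th color for each $j$, where $\mathbf{n}^m=(n_1,\ldots,n_m)$. -}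

module Defs where

open import Data.Nat using (ℕ; zero; suc; _+_; _*_; _∸_; _%_)
open import Data.Nat.DivMod using (m%n<n)
open import Data.Fin using (Fin; toℕ; fromℕ<)
open import Data.Fin.Properties using (any?; all?; _≟_)
open import Data.Vec using (Vec; []; _∷_; lookup)
open import Data.List using (List; []; _∷_; length; filter; deduplicate; concatMap; map)
open import Data.List.Base using (tabulate)
open import Data.Nat.ListAction using (sum)
open import Data.Product using (∃; _,_)
open import Data.Sum using (_⊎_)
open import Relation.Binary.PropositionalEquality using (_≡_)
open import Relation.Nullary using (Dec; yes; no)
open import Relation.Nullary.Decidable using (_⊎-dec_)
open import Relation.Binary.Definitions using (Decidable)
import Data.Nat as ℕ

Odd : ℕ → Set
Odd n = n % 2 ≡ 1

total : ∀ {m} → (Fin m → ℕ) → ℕ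
total n = sum (tabulate n)

Coloring : ℕ → ℕ → Set
Coloring m N = Vec (Fin m) N

allColorings : (m N : ℕ) → List (Coloring m N)
allColorings m zero = [] ∷ []
allColorings m (suc N) =
  concatMap (λ v → map (λ c → c ∷ v) (tabulate {n = m} (λ c → c))) (allColorings m N)

countColor : ∀ {m N} → Fin m → Coloring m N → ℕ
countColor j [] = 0
countColor j (x ∷ c) with x ≟ j
... | yes _ = suc (countColor j c)
... | no  _ = countColor j c

HasContent : ∀ {m N} → (Fin m → ℕ) → Coloring m N → Set
HasContent {m} n c = ∀ (j : Fin m) → countColor j c ≡ n j

hasContent? : ∀ {m N} (n : Fin m → ℕ) (c : Coloring m N) → Dec (HasContent n c)
hasContent? n c = all? (λ j → countColor j c ℕ.≟ n j)

rot : ∀ {N} → Fin N → Fin N → Fin N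
rot {suc k} r i = fromℕ< (m%n<n (toℕ r + toℕ i) (suc k))

refl' : ∀ {N} → Fin N → Fin N → Fin N
refl' {suc k} r i = fromℕ< (m%n<n (toℕ r + (suc k ∸ toℕ i)) (suc k))

CycEquiv : ∀ {m N} → Coloring m N → Coloring m N → Set
CycEquiv {m} {N} c c' = ∃ λ (r : Fin N) → ∀ (i : Fin N) → lookup c' i ≡ lookup c (rot r i)

DihEquiv : ∀ {m N} → Coloring m N → Coloring m N → Set
DihEquiv {m} {N} c c' =
  (∃ λ (r : Fin N) → ∀ (i : Fin N) → lookup c' i ≡ lookup c (rot r i)) ⊎
  (∃ λ (r : Fin N) → ∀ (i : Fin N) → lookup c' i ≡ lookup c (refl' r i))

cycEquiv? : ∀ {m N} → Decidable (CycEquiv {m} {N})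
cycEquiv? c c' = any? (λ r → all? (λ i → lookup c' i ≟ lookup c (rot r i)))

dihEquiv? : ∀ {m N} → Decidable (DihEquiv {m} {N})
dihEquiv? c c' =
  any? (λ r → all? (λ i → lookup c' i ≟ lookup c (rot r i))) ⊎-dec
  any? (λ r → all? (λ i → lookup c' i ≟ lookup c (refl' r i)))

colorings : ∀ {m} → (n : Fin m → ℕ) → List (Coloring m (total n))
colorings {m} n = filter (hasContent? n) (allColorings m (total n))

-- γ(C_N, n^m): number of equivalence classes (orbits) of colorings with content n
-- under rotation; computed as the number of pairwise-inequivalent
-- representatives left after removing every coloring equivalent to an earlier one.
γC : ∀ {m} → (Fin m → ℕ) → ℕ
γC n = length (deduplicate cycEquiv? (colorings n))

γD : ∀ {m} → (Fin m → ℕ) → ℕ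
γD n = length (deduplicate dihEquiv? (colorings n))

-- Reflecting a coloring through vertex 0 is an involution σ compatible with rotations, so the dihedral
-- class of c is the union of the cyclic classes of c and σ c. These two classes coincide exactly when c
-- is a rotation of its mirror image, i.e. when c has an axis of reflection symmetry. For odd N such an
-- axis passes through exactly one vertex and pairs off all the others, so at most one color occurs an
-- odd number of times. Hence, when two of the nⱼ are odd, every dihedral class consists of exactly two
-- cyclic classes.

module Submission where

open import Defs
open import Data.Nat using (ℕ; _*_; _≤_)
open import Data.Fin using (Fin)
open import Data.Product using (∃; ∃₂; _×_)
open import Relation.Binary.PropositionalEquality using (_≡_; _≢_)

open import Level using (Level)
open import Data.Nat using (zero; suc; _+_; _∸_; _%_; _/_; _<_; s≤s; z≤n)
open import Data.Nat.Properties
  using (+-comm; +-assoc; +-identityʳ; +-suc; +-cancelʳ-≡; *-suc; ≤-refl; ≤-trans; <⇒≤; m+[n∸m]≡n;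
         +-commutativeSemigroup)
open import Data.Nat.DivMod
  using (_mod_; m%n<n; m%n%n≡m%n; n%n≡0; m<n⇒m%n≡m; %-distribˡ-+; [m+kn]%n≡m%n; m≡m%n+[m/n]*n)
open import Data.Nat.Tactic.RingSolver using (solve-∀)
open import Algebra.Properties.CommutativeSemigroup +-commutativeSemigroup
  using (x∙yz≈y∙xz) renaming (interchange to +-interchange)
open import Data.Fin using (toℕ; fromℕ<) renaming (zero to fzero; suc to fsuc)
import Data.Fin.Properties as Fin
open import Data.Fin.Properties using (toℕ-fromℕ<; fromℕ<-cong; fromℕ<-toℕ; toℕ<n)
open import Data.Vec using (Vec; []; _∷_; lookup; tabulate)
open import Data.Vec.Properties using (lookup∘tabulate; tabulate∘lookup; tabulate-cong)
open import Data.List using (List; []; _∷_; length; filter; deduplicate; map)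
import Data.List as List
open import Data.List.Properties using (filter-accept; filter-reject; filter-all; filter-≐; length-filter)
open import Data.List.Membership.Propositional using (_∈_)
open import Data.List.Membership.Propositional.Properties
  using (∈-filter⁺; ∈-filter⁻; ∈-concatMap⁺; ∈-map⁺; ∈-tabulate⁺)
open import Data.List.Relation.Unary.Any using (Any; here; there)
import Data.List.Relation.Unary.Any as Any
import Data.List.Relation.Unary.Any.Properties as Any
import Data.List.Relation.Unary.All as All
open import Data.List.Relation.Unary.All.Properties using (All¬⇒¬Any)
open import Data.List.Relation.Unary.AllPairs using (AllPairs; _∷_)
open import Data.List.Relation.Unary.Unique.DecSetoid.Properties using (deduplicate-!)
open import Data.Product using (_,_; proj₁; proj₂; swap)
open import Data.Sum using (_⊎_; inj₁; inj₂; [_,_]; map₂)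
open import Data.Empty using (⊥-elim)
open import Function using (id; _∘_; _⇔_; mk⇔; Equivalence)
open Equivalence using (to; from)
open import Relation.Binary.PropositionalEquality
  using (refl; sym; trans; cong; cong₂; subst; module ≡-Reasoning)
import Relation.Binary.Reasoning.Setoid as SetoidReasoning
open import Relation.Binary
  using (Rel; IsEquivalence; IsDecEquivalence; Setoid; DecSetoid; _Respects_; _Preserves_⟶_)
import Relation.Binary as B
open import Relation.Nullary using (Dec; ¬_; ¬?; yes; no)
open import Relation.Unary using (Pred; Decidable; _∩_; _≐_)
open import Relation.Unary.Properties using (_∩?_)

private
  variable
    a ℓ ℓ′ p q : Level
    A : Set a

-- Cases are split in a local function: a `with` on P? x would block the `does (P? x)` inside filter.
filter-filter : {P : Pred A p} {Q : Pred A q} (P? : Decidable P) (Q? : Decidable Q) →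
                ∀ xs → filter P? (filter Q? xs) ≡ filter (P? ∩? Q?) xs
filter-filter P? Q? [] = refl
filter-filter {P = P} {Q = Q} P? Q? (x ∷ xs) = by-cases (P? x) (Q? x)
  where
  open ≡-Reasoning
  by-cases : Dec (P x) → Dec (Q x) → filter P? (filter Q? (x ∷ xs)) ≡ filter (P? ∩? Q?) (x ∷ xs)
  by-cases _ (no ¬q) = begin
    filter P? (filter Q? (x ∷ xs)) ≡⟨ cong (filter P?) (filter-reject Q? ¬q) ⟩
    filter P? (filter Q? xs)       ≡⟨ filter-filter P? Q? xs ⟩
    filter (P? ∩? Q?) xs           ≡⟨ filter-reject (P? ∩? Q?) (¬q ∘ proj₂) ⟨
    filter (P? ∩? Q?) (x ∷ xs)     ∎
  by-cases (no ¬p) (yes q) = begin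
    filter P? (filter Q? (x ∷ xs)) ≡⟨ cong (filter P?) (filter-accept Q? q) ⟩
    filter P? (x ∷ filter Q? xs)   ≡⟨ filter-reject P? ¬p ⟩
    filter P? (filter Q? xs)       ≡⟨ filter-filter P? Q? xs ⟩
    filter (P? ∩? Q?) xs           ≡⟨ filter-reject (P? ∩? Q?) (¬p ∘ proj₁) ⟨
    filter (P? ∩? Q?) (x ∷ xs)     ∎
  by-cases (yes p) (yes q) = begin
    filter P? (filter Q? (x ∷ xs)) ≡⟨ cong (filter P?) (filter-accept Q? q) ⟩
    filter P? (x ∷ filter Q? xs)   ≡⟨ filter-accept P? p ⟩
    x ∷ filter P? (filter Q? xs)   ≡⟨ cong (x ∷_) (filter-filter P? Q? xs) ⟩
    x ∷ filter (P? ∩? Q?) xs       ≡⟨ filter-accept (P? ∩? Q?) (p , q) ⟨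
    filter (P? ∩? Q?) (x ∷ xs)     ∎

filter-comm : {P : Pred A p} {Q : Pred A q} (P? : Decidable P) (Q? : Decidable Q) →
              ∀ xs → filter P? (filter Q? xs) ≡ filter Q? (filter P? xs)
filter-comm P? Q? xs = begin
  filter P? (filter Q? xs) ≡⟨ filter-filter P? Q? xs ⟩
  filter (P? ∩? Q?) xs     ≡⟨ filter-≐ (P? ∩? Q?) (Q? ∩? P?) (swap , swap) xs ⟩
  filter (Q? ∩? P?) xs     ≡⟨ filter-filter Q? P? xs ⟨
  filter Q? (filter P? xs) ∎
  where open ≡-Reasoning

module Deduplication {_≈_ : Rel A ℓ} (isDecEquivalence : IsDecEquivalence _≈_) where

  open IsDecEquivalence isDecEquivalence
    renaming (refl to ≈-refl; sym to ≈-sym; trans to ≈-trans; reflexive to ≈-reflexive)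

  decSetoid : DecSetoid _ _
  decSetoid = record { isDecEquivalence = isDecEquivalence }

  infixl 6 _∖_
  _∖_ : List A → A → List A
  xs ∖ x = filter (¬? ∘ (x ≟_)) xs

  ≉-respects-≈ : ∀ x → (λ y → ¬ x ≈ y) Respects _≈_
  ≉-respects-≈ x y≈z x≉y x≈z = x≉y (≈-trans x≈z (≈-sym y≈z))

  deduplicate-filter : {P : Pred A p} (P? : Decidable P) → P Respects _≈_ →
                       ∀ xs → deduplicate _≟_ (filter P? xs) ≡ filter P? (deduplicate _≟_ xs)
  deduplicate-filter P? resp [] = refl
  deduplicate-filter {P = P} P? resp (x ∷ xs) = by-cases (P? x)
    where
    open ≡-Reasoning
    by-cases : Dec (P x) → deduplicate _≟_ (filter P? (x ∷ xs)) ≡ filter P? (deduplicate _≟_ (x ∷ xs))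
    by-cases (yes px) = begin
      deduplicate _≟_ (filter P? (x ∷ xs))     ≡⟨ cong (deduplicate _≟_) (filter-accept P? px) ⟩
      x ∷ deduplicate _≟_ (filter P? xs) ∖ x   ≡⟨ cong (λ ys → x ∷ ys ∖ x) (deduplicate-filter P? resp xs) ⟩
      x ∷ filter P? (deduplicate _≟_ xs) ∖ x   ≡⟨ cong (x ∷_) (filter-comm _ P? (deduplicate _≟_ xs)) ⟩
      x ∷ filter P? (deduplicate _≟_ xs ∖ x)   ≡⟨ filter-accept P? px ⟨
      filter P? (deduplicate _≟_ (x ∷ xs))     ∎
    by-cases (no ¬px) = begin
      deduplicate _≟_ (filter P? (x ∷ xs))     ≡⟨ cong (deduplicate _≟_) (filter-reject P? ¬px) ⟩
      deduplicate _≟_ (filter P? xs)           ≡⟨ deduplicate-filter P? resp xs ⟩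
      filter P? (deduplicate _≟_ xs)           ≡⟨ filter-≐ P? (P? ∩? _) P≐P∩≉x (deduplicate _≟_ xs) ⟩
      filter (P? ∩? _) (deduplicate _≟_ xs)    ≡⟨ filter-filter P? _ (deduplicate _≟_ xs) ⟨
      filter P? (deduplicate _≟_ xs ∖ x)       ≡⟨ filter-reject P? ¬px ⟨
      filter P? (deduplicate _≟_ (x ∷ xs))     ∎
      where
      P≐P∩≉x : P ≐ (P ∩ λ y → ¬ x ≈ y)
      P≐P∩≉x = (λ py → py , λ x≈y → ¬px (resp (≈-sym x≈y) py)) , proj₁

  deduplicate-∷ : ∀ x xs → deduplicate _≟_ (x ∷ xs) ≡ x ∷ deduplicate _≟_ (xs ∖ x)
  deduplicate-∷ x xs = cong (x ∷_) (sym (deduplicate-filter _ (≉-respects-≈ x) xs))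

  length-∖-unique : ∀ {y ds} → AllPairs (λ u v → ¬ u ≈ v) ds → Any (y ≈_) ds →
                    length ds ≡ suc (length (ds ∖ y))
  length-∖-unique {y} {d ∷ ds} (d≉ds ∷ _) (here y≈d) = cong suc (begin
    length ds              ≡⟨ cong length (filter-all (¬? ∘ (y ≟_)) (All.map y≉ d≉ds)) ⟨
    length (ds ∖ y)        ≡⟨ cong length (filter-reject (¬? ∘ (y ≟_)) (λ ¬y≈d → ¬y≈d y≈d)) ⟨
    length ((d ∷ ds) ∖ y)  ∎)
    where
    open ≡-Reasoning
    y≉ : ∀ {e} → ¬ d ≈ e → ¬ y ≈ e
    y≉ d≉e y≈e = d≉e (≈-trans (≈-sym y≈d) y≈e)
  length-∖-unique {y} {d ∷ ds} (d≉ds ∷ ds!) (there y∈ds) = begin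
    suc (length ds)              ≡⟨ cong suc (length-∖-unique ds! y∈ds) ⟩
    suc (length (d ∷ ds ∖ y))    ≡⟨ cong (suc ∘ length) (filter-accept (¬? ∘ (y ≟_)) y≉d) ⟨
    suc (length ((d ∷ ds) ∖ y))  ∎
    where
    open ≡-Reasoning
    y≉d : ¬ y ≈ d
    y≉d y≈d = All¬⇒¬Any d≉ds (Any.map (≈-trans (≈-sym y≈d)) y∈ds)

  length-deduplicate-∈ : ∀ {y ys} → y ∈ ys →
                         length (deduplicate _≟_ ys) ≡ suc (length (deduplicate _≟_ (ys ∖ y)))
  length-deduplicate-∈ {y} {ys} y∈ys = begin
    length (deduplicate _≟_ ys)              ≡⟨ length-∖-unique (deduplicate-! decSetoid ys) y≈some ⟩
    suc (length (deduplicate _≟_ ys ∖ y))    ≡⟨ cong (suc ∘ length) (deduplicate-filter _ (≉-respects-≈ y) ys) ⟨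
    suc (length (deduplicate _≟_ (ys ∖ y)))  ∎
    where
    open ≡-Reasoning
    y≈some : Any (y ≈_) (deduplicate _≟_ ys)
    y≈some = Any.deduplicate⁺ _≟_ (λ z≈w y≈z → ≈-trans y≈z (≈-sym z≈w)) (Any.map ≈-reflexive y∈ys)

module Halving {_≈_ : Rel A ℓ} {_∼_ : Rel A ℓ′}
  (≈-isDecEquivalence : IsDecEquivalence _≈_) (_∼?_ : B.Decidable _∼_)
  (f : A → A) (f-involutive : ∀ x → f (f x) ≡ x) (f-cong : ∀ {x y} → x ≈ y → f x ≈ f y)
  (∼⇔≈⊎f≈ : ∀ {x y} → x ∼ y ⇔ (x ≈ y ⊎ f x ≈ y)) where

  open IsDecEquivalence ≈-isDecEquivalence
    renaming (refl to ≈-refl; sym to ≈-sym; trans to ≈-trans; reflexive to ≈-reflexive; _≟_ to _≈?_)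

  fx≈y⇒x≈fy : ∀ {x y} → f x ≈ y → x ≈ f y
  fx≈y⇒x≈fy {x} fx≈y = ≈-trans (≈-reflexive (sym (f-involutive x))) (f-cong fx≈y)

  ∼-isDecEquivalence : IsDecEquivalence _∼_
  ∼-isDecEquivalence = record
    { isEquivalence = record
      { refl  = from ∼⇔≈⊎f≈ (inj₁ ≈-refl)
      ; sym   = λ x∼y → from ∼⇔≈⊎f≈ (∼-sym (to ∼⇔≈⊎f≈ x∼y))
      ; trans = λ x∼y y∼z → from ∼⇔≈⊎f≈ (∼-trans (to ∼⇔≈⊎f≈ x∼y) (to ∼⇔≈⊎f≈ y∼z))
      }
    ; _≟_ = _∼?_
    }
    where
    ∼-sym : ∀ {x y} → x ≈ y ⊎ f x ≈ y → y ≈ x ⊎ f y ≈ x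
    ∼-sym (inj₁ x≈y)  = inj₁ (≈-sym x≈y)
    ∼-sym (inj₂ fx≈y) = inj₂ (≈-sym (fx≈y⇒x≈fy fx≈y))
    ∼-trans : ∀ {x y z} → x ≈ y ⊎ f x ≈ y → y ≈ z ⊎ f y ≈ z → x ≈ z ⊎ f x ≈ z
    ∼-trans (inj₁ x≈y)  (inj₁ y≈z)  = inj₁ (≈-trans x≈y y≈z)
    ∼-trans (inj₁ x≈y)  (inj₂ fy≈z) = inj₂ (≈-trans (f-cong x≈y) fy≈z)
    ∼-trans (inj₂ fx≈y) (inj₁ y≈z)  = inj₂ (≈-trans fx≈y y≈z)
    ∼-trans (inj₂ fx≈y) (inj₂ fy≈z) = inj₁ (≈-trans (fx≈y⇒x≈fy fx≈y) fy≈z)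

  module ≈ = Deduplication ≈-isDecEquivalence
  module ∼ = Deduplication ∼-isDecEquivalence

  x∼fy⇒x∼y : ∀ {x y} → x ∼ f y → x ∼ y
  x∼fy⇒x∼y {y = y} x∼fy with to ∼⇔≈⊎f≈ x∼fy
  ... | inj₁ x≈fy  = from ∼⇔≈⊎f≈ (inj₂ (subst (f _ ≈_) (f-involutive y) (f-cong x≈fy)))
  ... | inj₂ fx≈fy = from ∼⇔≈⊎f≈ (inj₁ (subst (_ ≈_) (f-involutive y) (fx≈y⇒x≈fy fx≈fy)))

  ∖-∖-f≡∖∼ : ∀ x xs → xs ≈.∖ x ≈.∖ f x ≡ xs ∼.∖ x
  ∖-∖-f≡∖∼ x xs = trans (filter-filter _ _ xs) (filter-≐ _ _ ≉∩≉⇔≁ xs)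
    where
    ≉∩≉⇔≁ : ((λ y → ¬ f x ≈ y) ∩ (λ y → ¬ x ≈ y)) ≐ (λ y → ¬ x ∼ y)
    ≉∩≉⇔≁ = (λ (fx≉y , x≉y) x∼y → [ x≉y , fx≉y ] (to ∼⇔≈⊎f≈ x∼y))
          , (λ x≁y → x≁y ∘ from ∼⇔≈⊎f≈ ∘ inj₂ , x≁y ∘ from ∼⇔≈⊎f≈ ∘ inj₁)

  f-Closed : List A → Set _
  f-Closed xs = ∀ {y} → y ∈ xs → f y ∈ xs

  Chiral : List A → Set _
  Chiral xs = ∀ {y} → y ∈ xs → ¬ y ≈ f y

  length-deduplicate-halves : ∀ xs → f-Closed xs → Chiral xs →
                              length (deduplicate _≈?_ xs) ≡ 2 * length (deduplicate _∼?_ xs)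
  length-deduplicate-halves xs = go (length xs) xs ≤-refl
    where
    go : ∀ n xs → length xs ≤ n → f-Closed xs → Chiral xs →
         length (deduplicate _≈?_ xs) ≡ 2 * length (deduplicate _∼?_ xs)
    go _       []       _           _      _    = refl
    go (suc n) (x ∷ xs) (s≤s |xs|≤n) closed chiral = begin
      length (deduplicate _≈?_ (x ∷ xs))                  ≡⟨ cong length (≈.deduplicate-∷ x xs) ⟩
      suc (length (deduplicate _≈?_ (xs ≈.∖ x)))          ≡⟨ cong suc (≈.length-deduplicate-∈ fx∈xs∖x) ⟩
      2 + length (deduplicate _≈?_ (xs ≈.∖ x ≈.∖ f x))    ≡⟨ cong (λ ys → 2 + length (deduplicate _≈?_ ys))
                                                                  (∖-∖-f≡∖∼ x xs) ⟩
      2 + length (deduplicate _≈?_ (xs ∼.∖ x))            ≡⟨ cong (2 +_) (go n (xs ∼.∖ x) |xs∖x|≤n closed′ chiral′) ⟩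
      2 + 2 * length (deduplicate _∼?_ (xs ∼.∖ x))        ≡⟨ *-suc 2 _ ⟨
      2 * length (x ∷ deduplicate _∼?_ (xs ∼.∖ x))        ≡⟨ cong (λ ys → 2 * length ys) (∼.deduplicate-∷ x xs) ⟨
      2 * length (deduplicate _∼?_ (x ∷ xs))              ∎
      where
      open ≡-Reasoning
      fx∈xs∖x : f x ∈ xs ≈.∖ x
      fx∈xs∖x with closed (here refl)
      ... | here fx≡x  = ⊥-elim (chiral (here refl) (≈-reflexive (sym fx≡x)))
      ... | there fx∈xs = ∈-filter⁺ _ fx∈xs (chiral (here refl))
      |xs∖x|≤n : length (xs ∼.∖ x) ≤ n
      |xs∖x|≤n = ≤-trans (length-filter _ xs) |xs|≤n
      closed′ : f-Closed (xs ∼.∖ x)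
      closed′ y∈xs∖x with ∈-filter⁻ _ y∈xs∖x
      ... | y∈xs , x≁y with closed (there y∈xs)
      ...   | here fy≡x   = ⊥-elim (x≁y (x∼fy⇒x∼y (subst (_∼ f _) fy≡x (from ∼⇔≈⊎f≈ (inj₁ ≈-refl)))))
      ...   | there fy∈xs = ∈-filter⁺ _ fy∈xs (x≁y ∘ x∼fy⇒x∼y)
      chiral′ : Chiral (xs ∼.∖ x)
      chiral′ = chiral ∘ there ∘ proj₁ ∘ ∈-filter⁻ _

∑ : ℕ → (ℕ → ℕ) → ℕ
∑ zero    g = 0
∑ (suc n) g = g 0 + ∑ n (g ∘ suc)

∑-cong : ∀ n {g h} → (∀ i → i < n → g i ≡ h i) → ∑ n g ≡ ∑ n h
∑-cong zero    g≡h = refl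
∑-cong (suc n) g≡h = cong₂ _+_ (g≡h 0 (s≤s z≤n)) (∑-cong n (λ i i<n → g≡h (suc i) (s≤s i<n)))

∑-suc : ∀ n g → ∑ (suc n) g ≡ ∑ n g + g n
∑-suc zero    g = +-comm (g 0) 0
∑-suc (suc n) g = trans (cong (g 0 +_) (∑-suc n (g ∘ suc))) (sym (+-assoc (g 0) _ _))

∑-+ : ∀ a b g → ∑ (a + b) g ≡ ∑ a g + ∑ b (λ i → g (a + i))
∑-+ zero    b g = refl
∑-+ (suc a) b g = trans (cong (g 0 +_) (∑-+ a b (g ∘ suc))) (sym (+-assoc (g 0) _ _))

∑-reverse : ∀ n g → ∑ n (λ i → g (n ∸ suc i)) ≡ ∑ n g
∑-reverse zero    g = refl
∑-reverse (suc n) g = begin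
  g n + ∑ n (λ i → g (n ∸ suc i))  ≡⟨ cong (g n +_) (∑-reverse n g) ⟩
  g n + ∑ n g                      ≡⟨ +-comm (g n) _ ⟩
  ∑ n g + g n                      ≡⟨ ∑-suc n g ⟨
  ∑ (suc n) g                      ∎
  where open ≡-Reasoning

∑-shift : ∀ n g → g n ≡ g 0 → ∑ n (g ∘ suc) ≡ ∑ n g
∑-shift n g gn≡g0 = +-cancelʳ-≡ (g 0) _ _ (begin
  ∑ n (g ∘ suc) + g 0  ≡⟨ +-comm _ (g 0) ⟩
  ∑ (suc n) g          ≡⟨ ∑-suc n g ⟩
  ∑ n g + g n          ≡⟨ cong (∑ n g +_) gn≡g0 ⟩
  ∑ n g + g 0          ∎)
  where open ≡-Reasoning

∑-rotate : ∀ n g → (∀ x → g (x + n) ≡ g x) → ∀ s → ∑ n (λ i → g (s + i)) ≡ ∑ n g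
∑-rotate n g periodic zero    = refl
∑-rotate n g periodic (suc s) = begin
  ∑ n (λ i → g (suc s + i))  ≡⟨ ∑-cong n (λ i _ → cong g (sym (+-suc s i))) ⟩
  ∑ n (λ i → g (s + suc i))  ≡⟨ ∑-shift n (λ i → g (s + i)) (trans (periodic s) (cong g (sym (+-identityʳ s)))) ⟩
  ∑ n (λ i → g (s + i))      ≡⟨ ∑-rotate n g periodic s ⟩
  ∑ n g                      ∎
  where open ≡-Reasoning

n*2≡n+n : ∀ n → n * 2 ≡ n + n
n*2≡n+n = solve-∀

odd-+-double : ∀ a b → Odd (a + (b + b)) → Odd a
odd-+-double a b odd = begin
  a % 2               ≡⟨ [m+kn]%n≡m%n a b 2 ⟨
  (a + b * 2) % 2     ≡⟨ cong (λ t → (a + t) % 2) (n*2≡n+n b) ⟩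
  (a + (b + b)) % 2   ≡⟨ odd ⟩
  1                   ∎
  where open ≡-Reasoning

indicator : ∀ {m} → Fin m → Fin m → ℕ
indicator j a with a Fin.≟ j
... | yes _ = 1
... | no  _ = 0

odd-indicator : ∀ {m} {j a : Fin m} → Odd (indicator j a) → a ≡ j
odd-indicator {j = j} {a} odd with a Fin.≟ j
... | yes a≡j = a≡j
... | no  _   with () ← odd

countColor≡∑ : ∀ {m} {n} (j : Fin m) (v : Vec (Fin m) n) (g : ℕ → ℕ) →
               (∀ i → g (toℕ i) ≡ indicator j (lookup v i)) → countColor j v ≡ ∑ n g
countColor≡∑ j []      g g≡ = refl
countColor≡∑ {n = suc n} j (x ∷ v) g g≡ with x Fin.≟ j | g≡ fzero
... | yes _ | g0≡1 = trans (cong suc (countColor≡∑ j v (g ∘ suc) (g≡ ∘ fsuc))) (cong (_+ ∑ n (g ∘ suc)) (sym g0≡1))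
... | no  _ | g0≡0 = trans (countColor≡∑ j v (g ∘ suc) (g≡ ∘ fsuc))           (cong (_+ ∑ n (g ∘ suc)) (sym g0≡0))

∈-allColorings : ∀ m N (c : Coloring m N) → c ∈ allColorings m N
∈-allColorings m zero    []      = here refl
∈-allColorings m (suc N) (x ∷ c) =
  ∈-concatMap⁺ (λ v → map (_∷ v) (List.tabulate id))
    (Any.map (λ { refl → ∈-map⁺ (_∷ c) (∈-tabulate⁺ x) }) (∈-allColorings m N c))

module Polygon (k : ℕ) {m : ℕ} where

  N : ℕ
  N = suc k

  -- Congruence modulo N; a record rather than a % N ≡ b % N so that a and b can be inferred.
  infix 4 _≋_
  record _≋_ (a b : ℕ) : Set where
    constructor mod-≡
    field %-≡ : a % N ≡ b % N
  open _≋_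

  ≋-isEquivalence : IsEquivalence _≋_
  ≋-isEquivalence = record
    { refl  = mod-≡ refl
    ; sym   = λ a≋b → mod-≡ (sym (%-≡ a≋b))
    ; trans = λ a≋b b≋c → mod-≡ (trans (%-≡ a≋b) (%-≡ b≋c))
    }

  ≋-setoid : Setoid _ _
  ≋-setoid = record { isEquivalence = ≋-isEquivalence }

  open IsEquivalence ≋-isEquivalence
    renaming (refl to ≋-refl; sym to ≋-sym; trans to ≋-trans; reflexive to ≡⇒≋)

  +-cong-≋ : ∀ {a a′ b b′} → a ≋ a′ → b ≋ b′ → a + b ≋ a′ + b′
  +-cong-≋ {a} {a′} {b} {b′} (mod-≡ a≡a′) (mod-≡ b≡b′) = mod-≡ (begin
    (a + b) % N              ≡⟨ %-distribˡ-+ a b N ⟩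
    (a % N + b % N) % N      ≡⟨ cong₂ (λ u v → (u + v) % N) a≡a′ b≡b′ ⟩
    (a′ % N + b′ % N) % N    ≡⟨ %-distribˡ-+ a′ b′ N ⟨
    (a′ + b′) % N            ∎)
    where open ≡-Reasoning

  +-congˡ-≋ : ∀ a {b b′} → b ≋ b′ → a + b ≋ a + b′
  +-congˡ-≋ a = +-cong-≋ (≋-refl {a})

  +-congʳ-≋ : ∀ {a a′} b → a ≋ a′ → a + b ≋ a′ + b
  +-congʳ-≋ b a≋a′ = +-cong-≋ a≋a′ (≋-refl {b})

  %-≋ : ∀ x → x % N ≋ x
  %-≋ x = mod-≡ (m%n%n≡m%n x N)

  N≋0 : N ≋ 0
  N≋0 = mod-≡ (n%n≡0 N)

  -- The inverse is represented in 1 … N, so neg 0 = N.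
  neg : ℕ → ℕ
  neg a = N ∸ a % N

  +-inverseʳ : ∀ a → a + neg a ≋ 0
  +-inverseʳ a = begin
    a + neg a        ≈⟨ +-congʳ-≋ (neg a) (≋-sym (%-≋ a)) ⟩
    a % N + neg a    ≡⟨ m+[n∸m]≡n (<⇒≤ (m%n<n a N)) ⟩
    N                ≈⟨ N≋0 ⟩
    0                ∎
    where open SetoidReasoning ≋-setoid

  neg-unique : ∀ {a b} → a + b ≋ 0 → b ≋ neg a
  neg-unique {a} {b} a+b≋0 = begin
    b                  ≈⟨ +-congʳ-≋ b (≋-sym (≋-trans (≡⇒≋ (+-comm (neg a) a)) (+-inverseʳ a))) ⟩
    (neg a + a) + b    ≡⟨ +-assoc (neg a) a b ⟩
    neg a + (a + b)    ≈⟨ +-congˡ-≋ (neg a) a+b≋0 ⟩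
    neg a + 0          ≡⟨ +-identityʳ (neg a) ⟩
    neg a              ∎
    where open SetoidReasoning ≋-setoid

  neg-involutive : ∀ a → neg (neg a) ≋ a
  neg-involutive a = ≋-sym (neg-unique (≋-trans (≡⇒≋ (+-comm (neg a) a)) (+-inverseʳ a)))

  neg-+ : ∀ a b → neg a + neg b ≋ neg (a + b)
  neg-+ a b = neg-unique {a + b} (begin
    (a + b) + (neg a + neg b)    ≡⟨ +-interchange a b (neg a) (neg b) ⟩
    (a + neg a) + (b + neg b)    ≈⟨ +-cong-≋ (+-inverseʳ a) (+-inverseʳ b) ⟩
    0                            ∎)
    where open SetoidReasoning ≋-setoid

  neg-flip : ∀ r x → r + neg x ≋ neg (neg r + x)
  neg-flip r x = begin
    r + neg x             ≈⟨ +-congʳ-≋ (neg x) (≋-sym (neg-involutive r)) ⟩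
    neg (neg r) + neg x   ≈⟨ neg-+ (neg r) x ⟩
    neg (neg r + x)       ∎
    where open SetoidReasoning ≋-setoid

  N∸≡neg : ∀ (i : Fin N) → N ∸ toℕ i ≡ neg (toℕ i)
  N∸≡neg i = cong (N ∸_) (sym (m<n⇒m%n≡m (toℕ<n i)))

  toℕ-mod-≋ : ∀ x → toℕ (x mod N) ≋ x
  toℕ-mod-≋ x = ≋-trans (≡⇒≋ (toℕ-fromℕ< _)) (%-≋ x)

  odd⇒N≡1+h+h : Odd N → N ≡ suc (N / 2 + N / 2)
  odd⇒N≡1+h+h odd = trans (m≡m%n+[m/n]*n N 2) (cong₂ _+_ odd (n*2≡n+n (N / 2)))

  -- With N = 2h + 1, the half of r is r (h + 1), since 2 r (h + 1) = r + r N.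
  halve : Odd N → ∀ r → ∃ λ s → s + s ≋ r
  halve odd r = s , mod-≡ (begin
    (s + s) % N                     ≡⟨ cong (_% N) (double r h) ⟩
    (r + r * suc (h + h)) % N       ≡⟨ cong (λ n → (r + r * n) % N) (odd⇒N≡1+h+h odd) ⟨
    (r + r * N) % N                 ≡⟨ [m+kn]%n≡m%n r r N ⟩
    r % N                           ∎)
    where
    open ≡-Reasoning
    h = N / 2
    s = r * suc h
    double : ∀ r h → r * suc h + r * suc h ≡ r + r * suc (h + h)
    double = solve-∀

  infixl 9 _⟨_⟩
  _⟨_⟩ : Coloring m N → ℕ → Fin m
  c ⟨ x ⟩ = lookup c (x mod N)

  ⟨⟩-cong : ∀ c {a b} → a ≋ b → c ⟨ a ⟩ ≡ c ⟨ b ⟩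
  ⟨⟩-cong c (mod-≡ a%≡b%) = cong (lookup c) (fromℕ<-cong _ _ a%≡b% _ _)

  lookup≡⟨toℕ⟩ : ∀ c (i : Fin N) → lookup c i ≡ c ⟨ toℕ i ⟩
  lookup≡⟨toℕ⟩ c i = cong (lookup c) (sym (begin
    toℕ i mod N                      ≡⟨ fromℕ<-cong _ _ (m<n⇒m%n≡m (toℕ<n i)) _ (toℕ<n i) ⟩
    fromℕ< (toℕ<n i)                 ≡⟨ fromℕ<-toℕ i (toℕ<n i) ⟩
    i                                ∎))
    where open ≡-Reasoning

  ⟨⟩-injective : ∀ {c c′} → (∀ x → c ⟨ x ⟩ ≡ c′ ⟨ x ⟩) → c ≡ c′
  ⟨⟩-injective {c} {c′} c≗c′ = begin
    c                    ≡⟨ tabulate∘lookup c ⟨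
    tabulate (lookup c)  ≡⟨ tabulate-cong lookup≗ ⟩
    tabulate (lookup c′) ≡⟨ tabulate∘lookup c′ ⟩
    c′                   ∎
    where
    open ≡-Reasoning
    lookup≗ : ∀ i → lookup c i ≡ lookup c′ i
    lookup≗ i = trans (lookup≡⟨toℕ⟩ c i) (trans (c≗c′ (toℕ i)) (sym (lookup≡⟨toℕ⟩ c′ i)))

  Rotated : Rel (Coloring m N) _
  Rotated c c′ = ∃ λ r → ∀ x → c′ ⟨ x ⟩ ≡ c ⟨ r + x ⟩

  cycEquiv⇔rotated : ∀ c c′ → CycEquiv c c′ ⇔ Rotated c c′
  cycEquiv⇔rotated c c′ = mk⇔
    (λ (r , c′≡) → toℕ r , λ x → trans (c′≡ (x mod N)) (⟨⟩-cong c (+-congˡ-≋ (toℕ r) (toℕ-mod-≋ x))))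
    (λ (r , c′≡) → r mod N , λ i → begin
      lookup c′ i                 ≡⟨ lookup≡⟨toℕ⟩ c′ i ⟩
      c′ ⟨ toℕ i ⟩                ≡⟨ c′≡ (toℕ i) ⟩
      c ⟨ r + toℕ i ⟩             ≡⟨ ⟨⟩-cong c (+-congʳ-≋ (toℕ i) (≋-sym (toℕ-mod-≋ r))) ⟩
      c ⟨ toℕ (r mod N) + toℕ i ⟩ ∎)
    where open ≡-Reasoning

  rotated-isEquivalence : IsEquivalence Rotated
  rotated-isEquivalence = record
    { refl  = 0 , λ x → refl
    ; sym   = λ {c} {c′} (r , c′≡) → neg r , λ x → sym (begin
        c′ ⟨ neg r + x ⟩        ≡⟨ c′≡ (neg r + x) ⟩
        c ⟨ r + (neg r + x) ⟩   ≡⟨ cong (c ⟨_⟩) (+-assoc r (neg r) x) ⟨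
        c ⟨ r + neg r + x ⟩     ≡⟨ ⟨⟩-cong c (+-congʳ-≋ x (+-inverseʳ r)) ⟩
        c ⟨ x ⟩                 ∎)
    ; trans = λ {c} {c′} {c″} (r , c′≡) (s , c″≡) → r + s , λ x → begin
        c″ ⟨ x ⟩                ≡⟨ c″≡ x ⟩
        c′ ⟨ s + x ⟩            ≡⟨ c′≡ (s + x) ⟩
        c ⟨ r + (s + x) ⟩       ≡⟨ cong (c ⟨_⟩) (+-assoc r s x) ⟨
        c ⟨ r + s + x ⟩         ∎
    }
    where open ≡-Reasoning

  reflect : Coloring m N → Coloring m N
  reflect c = tabulate (λ i → c ⟨ N ∸ toℕ i ⟩)

  reflect-⟨⟩ : ∀ c x → reflect c ⟨ x ⟩ ≡ c ⟨ neg x ⟩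
  reflect-⟨⟩ c x = trans (lookup∘tabulate (λ i → c ⟨ N ∸ toℕ i ⟩) (x mod N))
                        (cong (λ y → c ⟨ N ∸ y ⟩) (toℕ-fromℕ< (m%n<n x N)))

  reflect-involutive : ∀ c → reflect (reflect c) ≡ c
  reflect-involutive c = ⟨⟩-injective λ x → begin
    reflect (reflect c) ⟨ x ⟩   ≡⟨ reflect-⟨⟩ (reflect c) x ⟩
    reflect c ⟨ neg x ⟩         ≡⟨ reflect-⟨⟩ c (neg x) ⟩
    c ⟨ neg (neg x) ⟩           ≡⟨ ⟨⟩-cong c (neg-involutive x) ⟩
    c ⟨ x ⟩                     ∎
    where open ≡-Reasoning

  rotated-reflect : ∀ {c c′} → Rotated c c′ → Rotated (reflect c) (reflect c′)
  rotated-reflect {c} {c′} (r , c′≡) = neg r , λ x → begin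
    reflect c′ ⟨ x ⟩            ≡⟨ reflect-⟨⟩ c′ x ⟩
    c′ ⟨ neg x ⟩                ≡⟨ c′≡ (neg x) ⟩
    c ⟨ r + neg x ⟩             ≡⟨ ⟨⟩-cong c (neg-flip r x) ⟩
    c ⟨ neg (neg r + x) ⟩       ≡⟨ reflect-⟨⟩ c (neg r + x) ⟨
    reflect c ⟨ neg r + x ⟩     ∎
    where open ≡-Reasoning

  reflected⇔rotated : ∀ c c′ →
    (∃ λ (r : Fin N) → ∀ i → lookup c′ i ≡ lookup c (refl' r i)) ⇔ Rotated (reflect c) c′
  reflected⇔rotated c c′ = mk⇔
    (λ (r , c′≡) → neg (toℕ r) , λ x → begin
      c′ ⟨ x ⟩                              ≡⟨ c′≡ (x mod N) ⟩
      c ⟨ toℕ r + (N ∸ toℕ (x mod N)) ⟩     ≡⟨ cong (λ y → c ⟨ toℕ r + (N ∸ y) ⟩) (toℕ-fromℕ< (m%n<n x N)) ⟩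
      c ⟨ toℕ r + neg x ⟩                   ≡⟨ ⟨⟩-cong c (neg-flip (toℕ r) x) ⟩
      c ⟨ neg (neg (toℕ r) + x) ⟩           ≡⟨ reflect-⟨⟩ c (neg (toℕ r) + x) ⟨
      reflect c ⟨ neg (toℕ r) + x ⟩         ∎)
    (λ (s , c′≡) → neg s mod N , λ i → begin
      lookup c′ i                           ≡⟨ lookup≡⟨toℕ⟩ c′ i ⟩
      c′ ⟨ toℕ i ⟩                          ≡⟨ c′≡ (toℕ i) ⟩
      reflect c ⟨ s + toℕ i ⟩               ≡⟨ reflect-⟨⟩ c (s + toℕ i) ⟩
      c ⟨ neg (s + toℕ i) ⟩                 ≡⟨ ⟨⟩-cong c (≋-sym (neg-+ s (toℕ i))) ⟩
      c ⟨ neg s + neg (toℕ i) ⟩             ≡⟨ cong (λ y → c ⟨ neg s + y ⟩) (N∸≡neg i) ⟨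
      c ⟨ neg s + (N ∸ toℕ i) ⟩             ≡⟨ ⟨⟩-cong c (+-congʳ-≋ (N ∸ toℕ i) (≋-sym (toℕ-mod-≋ (neg s)))) ⟩
      c ⟨ toℕ (neg s mod N) + (N ∸ toℕ i) ⟩ ∎)
    where open ≡-Reasoning

  dihEquiv⇔ : ∀ {c c′} → DihEquiv c c′ ⇔ (CycEquiv c c′ ⊎ CycEquiv (reflect c) c′)
  dihEquiv⇔ {c} {c′} = mk⇔
    (map₂ (from (cycEquiv⇔rotated (reflect c) c′) ∘ to (reflected⇔rotated c c′)))
    (map₂ (from (reflected⇔rotated c c′) ∘ to (cycEquiv⇔rotated (reflect c) c′)))

  +≡N⇒≋neg : ∀ a {b} → a + b ≡ N → b ≋ neg a
  +≡N⇒≋neg a a+b≡N = neg-unique (≋-trans (≡⇒≋ a+b≡N) N≋0)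

  ∑-neg : ∀ {g} → g Preserves _≋_ ⟶ _≡_ → ∑ N (g ∘ neg) ≡ ∑ N g
  ∑-neg {g} g-cong = cong₂ _+_ (g-cong N≋0) (begin
    ∑ k (λ i → g (neg (suc i)))            ≡⟨ ∑-cong k (λ i i<k → g-cong (≋-sym (+≡N⇒≋neg (suc i) (suc-reflect i<k)))) ⟩
    ∑ k (λ i → g (suc (k ∸ suc i)))        ≡⟨ ∑-reverse k (g ∘ suc) ⟩
    ∑ k (g ∘ suc)                          ∎)
    where
    open ≡-Reasoning
    suc-reflect : ∀ {i} → i < k → suc i + suc (k ∸ suc i) ≡ N
    suc-reflect {i} i<k = trans (+-suc (suc i) (k ∸ suc i)) (cong suc (m+[n∸m]≡n i<k))

  ∑-symmetric : ∀ {g} → g Preserves _≋_ ⟶ _≡_ → (∀ x → g (neg x) ≡ g x) →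
                ∀ {h} → N ≡ suc (h + h) → ∑ N g ≡ g 0 + (∑ h (g ∘ suc) + ∑ h (g ∘ suc))
  ∑-symmetric {g} g-cong g-even {h} N≡1+2h = begin
    ∑ N g                                                  ≡⟨ cong (λ n → ∑ n g) N≡1+2h ⟩
    g 0 + ∑ (h + h) (g ∘ suc)                              ≡⟨ cong (g 0 +_) (∑-+ h h (g ∘ suc)) ⟩
    g 0 + (∑ h (g ∘ suc) + ∑ h (λ i → g (suc (h + i))))    ≡⟨ cong (λ t → g 0 + (∑ h (g ∘ suc) + t)) upper-half ⟩
    g 0 + (∑ h (g ∘ suc) + ∑ h (g ∘ suc))                  ∎
    where
    open ≡-Reasoning
    mirror : ∀ {i} → i < h → suc i + suc (h + (h ∸ suc i)) ≡ N
    mirror {i} i<h = begin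
      suc i + suc (h + (h ∸ suc i))    ≡⟨ +-suc (suc i) _ ⟩
      suc (suc i + (h + (h ∸ suc i)))  ≡⟨ cong suc (x∙yz≈y∙xz (suc i) h _) ⟩
      suc (h + (suc i + (h ∸ suc i)))  ≡⟨ cong (λ t → suc (h + t)) (m+[n∸m]≡n i<h) ⟩
      suc (h + h)                      ≡⟨ N≡1+2h ⟨
      N                                ∎
    upper-half : ∑ h (λ i → g (suc (h + i))) ≡ ∑ h (g ∘ suc)
    upper-half = begin
      ∑ h (λ i → g (suc (h + i)))              ≡⟨ ∑-reverse h (λ i → g (suc (h + i))) ⟨
      ∑ h (λ i → g (suc (h + (h ∸ suc i))))    ≡⟨ ∑-cong h (λ i i<h → g-cong (+≡N⇒≋neg (suc i) (mirror i<h))) ⟩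
      ∑ h (λ i → g (neg (suc i)))              ≡⟨ ∑-cong h (λ i _ → g-even (suc i)) ⟩
      ∑ h (g ∘ suc)                            ∎

  countColor≡∑⟨⟩ : ∀ j c → countColor j c ≡ ∑ N (λ x → indicator j (c ⟨ x ⟩))
  countColor≡∑⟨⟩ j c =
    countColor≡∑ j c (λ x → indicator j (c ⟨ x ⟩)) (λ i → cong (indicator j) (sym (lookup≡⟨toℕ⟩ c i)))

  countColor-reflect : ∀ j c → countColor j (reflect c) ≡ countColor j c
  countColor-reflect j c = begin
    countColor j (reflect c)                         ≡⟨ countColor≡∑⟨⟩ j (reflect c) ⟩
    ∑ N (λ x → indicator j (reflect c ⟨ x ⟩))        ≡⟨ ∑-cong N (λ x _ → cong (indicator j) (reflect-⟨⟩ c x)) ⟩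
    ∑ N (λ x → indicator j (c ⟨ neg x ⟩))            ≡⟨ ∑-neg (cong (indicator j) ∘ ⟨⟩-cong c) ⟩
    ∑ N (λ x → indicator j (c ⟨ x ⟩))                ≡⟨ countColor≡∑⟨⟩ j c ⟨
    countColor j c                                   ∎
    where open ≡-Reasoning

  reflection-axis : Odd N → ∀ {c} → Rotated c (reflect c) → ∃ λ s → ∀ x → c ⟨ s + neg x ⟩ ≡ c ⟨ s + x ⟩
  reflection-axis odd {c} (r , reflect≡) with halve odd r
  ... | s , s+s≋r = s , λ x → begin
    c ⟨ s + neg x ⟩                  ≡⟨ ⟨⟩-cong c (neg-flip s x) ⟩
    c ⟨ neg (neg s + x) ⟩            ≡⟨ reflect-⟨⟩ c (neg s + x) ⟨
    reflect c ⟨ neg s + x ⟩          ≡⟨ reflect≡ (neg s + x) ⟩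
    c ⟨ r + (neg s + x) ⟩            ≡⟨ ⟨⟩-cong c (+-congʳ-≋ (neg s + x) (≋-sym s+s≋r)) ⟩
    c ⟨ (s + s) + (neg s + x) ⟩      ≡⟨ cong (c ⟨_⟩) (+-interchange s s (neg s) x) ⟩
    c ⟨ (s + neg s) + (s + x) ⟩      ≡⟨ ⟨⟩-cong c (+-congʳ-≋ (s + x) (+-inverseʳ s)) ⟩
    c ⟨ s + x ⟩                      ∎
    where open ≡-Reasoning

  odd-count-on-axis : ∀ {c s} → (∀ x → c ⟨ s + neg x ⟩ ≡ c ⟨ s + x ⟩) → Odd N →
                      ∀ {j} → Odd (countColor j c) → c ⟨ s ⟩ ≡ j
  odd-count-on-axis {c} {s} symmetric odd {j} odd-count =
    trans (cong (c ⟨_⟩) (sym (+-identityʳ s)))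
          (odd-indicator (odd-+-double (e (s + 0)) S (subst Odd count≡ odd-count)))
    where
    open ≡-Reasoning
    e : ℕ → ℕ
    e x = indicator j (c ⟨ x ⟩)
    e-cong : e Preserves _≋_ ⟶ _≡_
    e-cong = cong (indicator j) ∘ ⟨⟩-cong c
    e-periodic : ∀ x → e (x + N) ≡ e x
    e-periodic x = e-cong {x + N} {x} (≋-trans (+-congˡ-≋ x N≋0) (≡⇒≋ (+-identityʳ x)))
    S : ℕ
    S = ∑ (N / 2) (λ i → e (s + suc i))
    count≡ : countColor j c ≡ e (s + 0) + (S + S)
    count≡ = begin
      countColor j c          ≡⟨ countColor≡∑⟨⟩ j c ⟩
      ∑ N e                   ≡⟨ ∑-rotate N e e-periodic s ⟨
      ∑ N (λ x → e (s + x))   ≡⟨ ∑-symmetric (e-cong ∘ +-congˡ-≋ s) (cong (indicator j) ∘ symmetric)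
                                             {N / 2} (odd⇒N≡1+h+h odd) ⟩
      e (s + 0) + (S + S)     ∎

  odd-colors-unique : Odd N → ∀ {c} → CycEquiv c (reflect c) →
                      ∀ {j j′} → Odd (countColor j c) → Odd (countColor j′ c) → j ≡ j′
  odd-colors-unique odd {c} c∼reflect-c {j} {j′} odd-j odd-j′
    with reflection-axis odd {c} (to (cycEquiv⇔rotated c (reflect c)) c∼reflect-c)
  ... | s , symmetric = trans (sym (odd-count-on-axis {c} {s} symmetric odd {j} odd-j))
                              (odd-count-on-axis {c} {s} symmetric odd {j′} odd-j′)

  cycEquiv-isDecEquivalence : IsDecEquivalence (CycEquiv {m} {N})
  cycEquiv-isDecEquivalence = record
    { isEquivalence = record
      { refl  = λ {c} → from (cycEquiv⇔rotated c c) (R.refl {c})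
      ; sym   = λ {c} {c′} → from (cycEquiv⇔rotated c′ c) ∘ R.sym {c} {c′} ∘ to (cycEquiv⇔rotated c c′)
      ; trans = λ {c} {c′} {c″} p q → from (cycEquiv⇔rotated c c″)
          (R.trans {c} {c′} {c″} (to (cycEquiv⇔rotated c c′) p) (to (cycEquiv⇔rotated c′ c″) q))
      }
    ; _≟_ = cycEquiv?
    }
    where module R = IsEquivalence rotated-isEquivalence

  reflect-cong : ∀ {c c′} → CycEquiv c c′ → CycEquiv (reflect c) (reflect c′)
  reflect-cong {c} {c′} =
    from (cycEquiv⇔rotated (reflect c) (reflect c′)) ∘ rotated-reflect {c} {c′} ∘ to (cycEquiv⇔rotated c c′)

  withContent : (Fin m → ℕ) → List (Coloring m N)
  withContent n = filter (hasContent? n) (allColorings m N)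

  ∈-withContent⁻ : ∀ {n c} → c ∈ withContent n → HasContent n c
  ∈-withContent⁻ {n} = proj₂ ∘ ∈-filter⁻ (hasContent? n) {xs = allColorings m N}

  reflect-∈-withContent : ∀ {n c} → c ∈ withContent n → reflect c ∈ withContent n
  reflect-∈-withContent {n} {c} c∈ = ∈-filter⁺ (hasContent? n) (∈-allColorings m N (reflect c))
    (λ j → trans (countColor-reflect j c) (∈-withContent⁻ c∈ j))

  2*γD≡γC : (n : Fin m → ℕ) → Odd N → (∃₂ λ j j′ → j ≢ j′ × Odd (n j) × Odd (n j′)) →
            2 * length (deduplicate dihEquiv? (withContent n)) ≡ length (deduplicate cycEquiv? (withContent n))
  2*γD≡γC n odd (j , j′ , j≢j′ , odd-j , odd-j′) =
    sym (length-deduplicate-halves (withContent n) reflect-∈-withContent not-self-reflected)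
    where
    open Halving cycEquiv-isDecEquivalence dihEquiv? reflect reflect-involutive
      (λ {c} {c′} → reflect-cong {c} {c′}) (λ {c} {c′} → dihEquiv⇔ {c} {c′})
    not-self-reflected : ∀ {c} → c ∈ withContent n → ¬ CycEquiv c (reflect c)
    not-self-reflected {c} c∈ c∼reflect-c = j≢j′ (odd-colors-unique odd {c} c∼reflect-c
      (subst Odd (sym (∈-withContent⁻ c∈ j)) odd-j) (subst Odd (sym (∈-withContent⁻ c∈ j′)) odd-j′))

mainTheorem2 : (m : ℕ) → 1 ≤ m → (n : Fin m → ℕ) → (∀ j → 1 ≤ n j) →
    Odd (total n) →
    (∃₂ λ (j k : Fin m) → j ≢ k × Odd (n j) × Odd (n k)) →
    2 * γD n ≡ γC n
mainTheorem2 m _ n _ odd two-odd = for-length (total n) odd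
  where
  for-length : ∀ N → Odd N → let cs = filter (hasContent? n) (allColorings m N) in
               2 * length (deduplicate dihEquiv? cs) ≡ length (deduplicate cycEquiv? cs)
  for-length zero    ()
  for-length (suc k) odd = Polygon.2*γD≡γC k n odd two-odd
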